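{- Let $P=(V,\prec_P)$ be a partial order, and suppose there are a linear order $L=(V,\prec_L)$ and an interval order $P_I=(V,\prec_I)$ with $P=L\cap P_I$. Then for any four distinct elements $a_0,a_1,b_0,b_1\in V$ forming a suborder $\mathbf{2+2}$ in $P$ (i.e. whose only relations in $P$ among them are $a_0\prec_P b_0$ and $a_1\prec_P b_1$), the equivalences $a_0\prec_L a_1 \iff b_0\prec_L a_1 \iff b_0\prec_L b_1 \iff a_0\prec_L b_1$ hold.
   Context: A partial order is a pair $(V,\prec)$ with $V$ finite and $\prec$ irreflexive and transitive; a linear order is one in which any two distinct elements are comparable. An interval order is a partial order $(V,\prec_I)$ for which each $v\in V$ can be assigned a closed real interval $[l(v),r(v)]$ with $u\prec_I v\iff r(u)<l(v)$. The intersection $L\cap P_I$ is the partial order on $V$ in which $u\prec v$ iff $u\prec_L v$ and $u\prec_I v$. -}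

module Defs where

open import Data.Nat using (ℕ)
open import Data.Fin using (Fin)
open import Data.Product using (_×_; Σ; ∃)
open import Data.Sum using (_⊎_)
open import Relation.Nullary using (¬_)
open import Relation.Binary.PropositionalEquality using (_≡_; _≢_)
open import Relation.Binary.Bundles using (StrictTotalOrder)
open import Function.Bundles using (_⇔_)
open import Level using (0ℓ)

Rel : ℕ → Set₁
Rel n = Fin n → Fin n → Set

record IsPartialOrder {n : ℕ} (_≺_ : Rel n) : Set where
  field
    irrefl : ∀ u → ¬ (u ≺ u)
    trans  : ∀ {u v w} → u ≺ v → v ≺ w → u ≺ w

record IsLinearOrder {n : ℕ} (_≺_ : Rel n) : Set where
  field
    isPartialOrder : IsPartialOrder _≺_
    total          : ∀ u v → u ≢ v → (u ≺ v) ⊎ (v ≺ u)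

-- An interval representation of _≺_ with endpoints in the linearly ordered
-- set R (closed intervals [l v , r v], so l v ≤ r v):  u ≺ v  iff  r u < l v.
record IntervalRep {n : ℕ} (R : StrictTotalOrder 0ℓ 0ℓ 0ℓ) (_≺_ : Rel n) : Set where
  open StrictTotalOrder R renaming (Carrier to Rc)
  field
    l r     : Fin n → Rc
    closed  : ∀ v → ¬ (r v < l v)
    rep     : ∀ u v → (u ≺ v) ⇔ (r u < l v)

record IsIntervalOrder {n : ℕ} (R : StrictTotalOrder 0ℓ 0ℓ 0ℓ) (_≺_ : Rel n) : Set where
  field
    isPartialOrder : IsPartialOrder _≺_
    intervals      : IntervalRep R _≺_

_∩_ : {n : ℕ} → Rel n → Rel n → Rel n
(L ∩ I) u v = L u v × I u v

_≐_ : {n : ℕ} → Rel n → Rel n → Set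
P ≐ Q = ∀ u v → P u v ⇔ Q u v

record Is2+2 {n : ℕ} (P : Rel n) (a₀ a₁ b₀ b₁ : Fin n) : Set where
  field
    a₀≢a₁ : a₀ ≢ a₁
    a₀≢b₀ : a₀ ≢ b₀
    a₀≢b₁ : a₀ ≢ b₁
    a₁≢b₀ : a₁ ≢ b₀
    a₁≢b₁ : a₁ ≢ b₁
    b₀≢b₁ : b₀ ≢ b₁
    a₀b₀ : P a₀ b₀
    a₁b₁ : P a₁ b₁
    ¬b₀a₀ : ¬ P b₀ a₀
    ¬b₁a₁ : ¬ P b₁ a₁
    ¬a₀a₁ : ¬ P a₀ a₁
    ¬a₁a₀ : ¬ P a₁ a₀
    ¬a₀b₁ : ¬ P a₀ b₁
    ¬b₁a₀ : ¬ P b₁ a₀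
    ¬a₁b₀ : ¬ P a₁ b₀
    ¬b₀a₁ : ¬ P b₀ a₁
    ¬b₀b₁ : ¬ P b₀ b₁
    ¬b₁b₀ : ¬ P b₁ b₀

module Submission where

-- Interval orders contain no 2+2: if u ≺ v and w ≺ x in an
-- interval order then u ≺ x or w ≺ v (compare the right end of u with the
-- left end of x).  Applied to a₀ ≺ b₀ and a₁ ≺ b₁ in P_I this gives
-- a₀ ≺_I b₁ or a₁ ≺_I b₀.  Since P = L ∩ P_I and the 2+2 forbids a₀ ≺_P b₁
-- and a₁ ≺_P b₀, the comparable pair must be reversed in L: either
-- b₁ ≺_L a₀ or b₀ ≺_L a₁.  Together with a₀ ≺_L b₀ and a₁ ≺_L b₁ (again
-- from P ⊆ L) this yields an L-chain a₁ b₁ a₀ b₀ or a₀ b₀ a₁ b₁.  Along the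
-- second chain all four relations a₀a₁, b₀a₁, b₀b₁, a₀b₁ hold in L; along
-- the first their reverses hold, so by asymmetry all four fail.  In both
-- cases the four statements are equivalent.

open import Defs
open import Data.Nat using (ℕ)
open import Data.Fin using (Fin)
open import Data.Product using (_×_; _,_; proj₁; proj₂)
open import Data.Sum using (_⊎_; inj₁; inj₂)
open import Data.Empty using (⊥-elim)
open import Relation.Nullary using (¬_)
open import Relation.Binary.Bundles using (StrictTotalOrder)
open import Relation.Binary.Definitions using (tri<; tri≈; tri>)
open import Relation.Binary.PropositionalEquality using (_≢_)
open import Function using (_∘_)
open import Function.Bundles using (_⇔_; mk⇔; Equivalence)
open import Level using (0ℓ)

both⇔ : {A B : Set} → A → B → A ⇔ B
both⇔ a b = mk⇔ (λ _ → b) (λ _ → a)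

neither⇔ : {A B : Set} → ¬ A → ¬ B → A ⇔ B
neither⇔ ¬a ¬b = mk⇔ (λ a → ⊥-elim (¬a a)) (λ b → ⊥-elim (¬b b))

module IntervalFacts {n : ℕ} (R : StrictTotalOrder 0ℓ 0ℓ 0ℓ) {_≺_ : Rel n}
                     (intervals : IntervalRep R _≺_) where
  open StrictTotalOrder R
  open IntervalRep intervals

  ends : ∀ {u v} → u ≺ v → r u < l v
  ends {u} {v} = Equivalence.to (rep u v)

  fromEnds : ∀ {u v} → r u < l v → u ≺ v
  fromEnds {u} {v} = Equivalence.from (rep u v)

  -- If r u < l x then u ≺ x; otherwise r w < l x ≤ r u < l v, so w ≺ v.
  ferrers : ∀ {u v w x} → u ≺ v → w ≺ x → (u ≺ x) ⊎ (w ≺ v)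
  ferrers {u} {v} {w} {x} u≺v w≺x with compare (r u) (l x)
  ... | tri< ru<lx _ _ = inj₁ (fromEnds ru<lx)
  ... | tri≈ _ ru≈lx _ =
    inj₂ (fromEnds (trans (<-respʳ-≈ (Eq.sym ru≈lx) (ends w≺x)) (ends u≺v)))
  ... | tri> _ _ lx<ru = inj₂ (fromEnds (trans (trans (ends w≺x) lx<ru) (ends u≺v)))

module LinearFacts {n : ℕ} {L : Rel n} (linear : IsLinearOrder L) where
  open IsLinearOrder linear using (total; isPartialOrder)
  open IsPartialOrder isPartialOrder

  asym : ∀ {u v} → L u v → ¬ L v u
  asym {u} u<v v<u = irrefl u (trans u<v v<u)

  reversed : {P I : Rel n} → P ≐ (L ∩ I) →
    ∀ {u v} → u ≢ v → I u v → ¬ P u v → L v u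
  reversed P≐L∩I {u} {v} u≢v Iuv ¬Puv with total u v u≢v
  ... | inj₁ Luv = ⊥-elim (¬Puv (Equivalence.from (P≐L∩I u v) (Luv , Iuv)))
  ... | inj₂ Lvu = Lvu

  Before : (a₀ b₀ a₁ b₁ : Fin n) → Set
  Before a₀ b₀ a₁ b₁ = L a₀ a₁ × L b₀ a₁ × L b₀ b₁ × L a₀ b₁

  chain⇒before : ∀ {a₀ b₀ a₁ b₁} →
    L a₀ b₀ → L b₀ a₁ → L a₁ b₁ → Before a₀ b₀ a₁ b₁
  chain⇒before a₀<b₀ b₀<a₁ a₁<b₁ =
    trans a₀<b₀ b₀<a₁ , b₀<a₁ , trans b₀<a₁ a₁<b₁
    , trans (trans a₀<b₀ b₀<a₁) a₁<b₁

  before⇒equiv : ∀ {a₀ b₀ a₁ b₁} → Before a₀ b₀ a₁ b₁ →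
    (L a₀ a₁ ⇔ L b₀ a₁) × (L b₀ a₁ ⇔ L b₀ b₁) × (L b₀ b₁ ⇔ L a₀ b₁)
  before⇒equiv (p , q , r , s) = both⇔ p q , both⇔ q r , both⇔ r s

  after⇒equiv : ∀ {a₀ b₀ a₁ b₁} → Before a₁ b₁ a₀ b₀ →
    (L a₀ a₁ ⇔ L b₀ a₁) × (L b₀ a₁ ⇔ L b₀ b₁) × (L b₀ b₁ ⇔ L a₀ b₁)
  after⇒equiv (a₁<a₀ , b₁<a₀ , b₁<b₀ , a₁<b₀) =
      neither⇔ (asym a₁<a₀) (asym a₁<b₀)
    , neither⇔ (asym a₁<b₀) (asym b₁<b₀)
    , neither⇔ (asym b₁<b₀) (asym b₁<a₀)

lemma2 : (R : StrictTotalOrder 0ℓ 0ℓ 0ℓ) (n : ℕ) (P L I : Rel n) →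
    IsPartialOrder P → IsLinearOrder L → IsIntervalOrder R I → P ≐ (L ∩ I) →
    (a₀ a₁ b₀ b₁ : Fin n) → Is2+2 P a₀ a₁ b₀ b₁ →
    (L a₀ a₁ ⇔ L b₀ a₁) × (L b₀ a₁ ⇔ L b₀ b₁) × (L b₀ b₁ ⇔ L a₀ b₁)
lemma2 R n P L I _ linear interval P≐L∩I a₀ a₁ b₀ b₁ twoPlusTwo =
  conclude (ferrers (inI a₀b₀) (inI a₁b₁))
  where
  open Is2+2 twoPlusTwo
  open IntervalFacts R (IsIntervalOrder.intervals interval) using (ferrers)
  open LinearFacts linear

  inL : ∀ {u v} → P u v → L u v
  inL {u} {v} = proj₁ ∘ Equivalence.to (P≐L∩I u v)

  inI : ∀ {u v} → P u v → I u v
  inI {u} {v} = proj₂ ∘ Equivalence.to (P≐L∩I u v)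

  -- a₀ ≺_I b₁ forces the chain a₁ b₁ a₀ b₀ in L; a₁ ≺_I b₀ forces a₀ b₀ a₁ b₁.
  conclude : I a₀ b₁ ⊎ I a₁ b₀ →
    (L a₀ a₁ ⇔ L b₀ a₁) × (L b₀ a₁ ⇔ L b₀ b₁) × (L b₀ b₁ ⇔ L a₀ b₁)
  conclude (inj₁ a₀≺b₁) = after⇒equiv
    (chain⇒before (inL a₁b₁) (reversed P≐L∩I a₀≢b₁ a₀≺b₁ ¬a₀b₁) (inL a₀b₀))
  conclude (inj₂ a₁≺b₀) = before⇒equiv
    (chain⇒before (inL a₀b₀) (reversed P≐L∩I a₁≢b₀ a₁≺b₀ ¬a₁b₀) (inL a₁b₁))
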